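{- Bipartiteness cannot be expressed in $\mathrm{FO}+\mathrm{conn}$: there is no $\mathrm{FO}+\mathrm{conn}$ sentence $\varphi$ over $\{E\}$ such that for every finite graph $G$, $G\models\varphi$ iff $G$ is bipartite.
   Context: Graphs are finite simple undirected graphs viewed as $\{E\}$-structures with $E$ irreflexive and symmetric. Separator logic $\mathrm{FO}+\mathrm{conn}$ is first-order logic over $\{E\}\cup\{\mathrm{conn}_k:k\ge0\}$, where $\mathrm{conn}_k$ is $(k+2)$-ary and $G\models\mathrm{conn}_k(a,b,c_1,\dots,c_k)$ iff $a$ and $b$ are connected by a path in $G-\{c_1,\dots,c_k\}$ (false if $a$ or $b$ equals some $c_i$). -}

module Defs where

open import Data.Nat using (ℕ; zero; suc)
open import Data.Fin using (Fin; zero; suc)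
open import Data.Vec using (Vec; lookup)
open import Data.Bool using (Bool; true; false)
open import Data.Product using (Σ; _×_; ∃)
open import Data.Sum using (_⊎_)
open import Data.Empty using (⊥)
open import Data.Unit using (⊤)
open import Relation.Nullary using (¬_)
open import Relation.Binary.PropositionalEquality using (_≡_; _≢_)

record Graph : Set where
  field
    n     : ℕ
    adj   : Fin n → Fin n → Bool
    irrefl : ∀ v → adj v v ≡ false
    sym    : ∀ u v → adj u v ≡ adj v u

open Graph public

Vertex : Graph → Set
Vertex G = Fin (n G)

Edge : (G : Graph) → Vertex G → Vertex G → Set
Edge G u v = adj G u v ≡ true

Avoids : ∀ {A : Set} {k} → Vec A k → A → Set
Avoids cs v = ∀ i → lookup cs i ≢ v

data Reach (G : Graph) {k : ℕ} (cs : Vec (Vertex G) k) (a : Vertex G) : Vertex G → Set where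
  here : Avoids cs a → Reach G cs a a
  step : ∀ {b c} → Reach G cs a b → Edge G b c → Avoids cs c → Reach G cs a c

-- Formulas of separator logic FO+conn over {E}, with free variables Fin m
-- (de Bruijn indices; the quantifiers bind variable zero).
data Formula (m : ℕ) : Set where
  eq    : Fin m → Fin m → Formula m
  edge  : Fin m → Fin m → Formula m
  conn  : (k : ℕ) → Fin m → Fin m → Vec (Fin m) k → Formula m
  ⊤f    : Formula m
  ⊥f    : Formula m
  neg   : Formula m → Formula m
  and   : Formula m → Formula m → Formula m
  or    : Formula m → Formula m → Formula m
  imp   : Formula m → Formula m → Formula m
  ex    : Formula (suc m) → Formula m
  all   : Formula (suc m) → Formula m

Sentence : Set
Sentence = Formula zero

extend : ∀ {A : Set} {m} → A → (Fin m → A) → Fin (suc m) → A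
extend a ρ zero    = a
extend a ρ (suc i) = ρ i

mapVec : ∀ {A B : Set} {k} → (A → B) → Vec A k → Vec B k
mapVec = Data.Vec.map

Sat : (G : Graph) → ∀ {m} → (Fin m → Vertex G) → Formula m → Set
Sat G ρ (eq x y)        = ρ x ≡ ρ y
Sat G ρ (edge x y)      = Edge G (ρ x) (ρ y)
Sat G ρ (conn k x y cs) = Reach G (mapVec ρ cs) (ρ x) (ρ y)
Sat G ρ ⊤f              = ⊤
Sat G ρ ⊥f              = ⊥
Sat G ρ (neg φ)         = ¬ Sat G ρ φ
Sat G ρ (and φ ψ)       = Sat G ρ φ × Sat G ρ ψ
Sat G ρ (or φ ψ)        = Sat G ρ φ ⊎ Sat G ρ ψ
Sat G ρ (imp φ ψ)       = Sat G ρ φ → Sat G ρ ψ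
Sat G ρ (ex φ)          = Σ (Vertex G) λ v → Sat G (extend v ρ) φ
Sat G ρ (all φ)         = (v : Vertex G) → Sat G (extend v ρ) φ

emptyAssign : ∀ {A : Set} → Fin zero → A
emptyAssign ()

_⊨_ : Graph → Sentence → Set
G ⊨ φ = Sat G emptyAssign φ

Bipartite : Graph → Set
Bipartite G = Σ (Vertex G → Bool) λ col → ∀ u v → Edge G u v → col u ≢ col v

{-# OPTIONS --safe #-}
module Submission where

open import Defs hiding (sym)
open import Data.Bool using (Bool; true; not)
import Data.Bool.Properties as Bool
open import Data.Empty using (⊥-elim)
open import Data.Fin using (Fin; zero; suc; toℕ; fromℕ<; combine; remQuot)
import Data.Fin.Properties as Fin
open import Data.Integer using (ℤ; +_; -[1+_]; ∣_∣; _+_; _-_; -_; _*_; _⊖_; 0ℤ; 1ℤ; -1ℤ)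
open import Data.Integer.DivMod using (_%ℕ_; _/ℕ_; n%ℕd<d; a≡a%ℕn+[a/ℕn]*n)
open import Data.Integer.Divisibility.Signed
  using (_∣_; divides; _∣?_; ∣-refl; ∣-trans; ∣m⇒∣-m; ∣m∣n⇒∣m+n; ∣m∣n⇒∣m-n; ∣⇒∣ᵤ; ∣ᵤ⇒∣)
import Data.Integer.Properties as ℤ
open import Data.Integer.Tactic.RingSolver using (solve-∀)
open import Data.Nat as ℕ using (ℕ; zero; suc; NonZero)
open import Data.Nat.DivMod using (_%_; _/_; m≡m%n+[m/n]*n; m%n<n)
import Data.Nat.Divisibility as ℕ
open import Data.Nat.GeneralisedArithmetic using (fold)
import Data.Nat.Properties as ℕ
open import Data.Product using (Σ; _×_; _,_; ∃; proj₁; proj₂)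
open import Data.Product.Function.NonDependent.Propositional using (_×-⇔_)
open import Data.Sum using (_⊎_; inj₁; inj₂)
open import Data.Sum.Function.Propositional using (_⊎-⇔_)
open import Data.Vec using (Vec; lookup)
import Data.Vec.Properties as Vec
open import Function.Base using (_∘_)
open import Function.Bundles using (_⇔_; mk⇔; Equivalence)
open import Function.Definitions using (Injective)
import Function.Properties.Equivalence as ⇔
open import Function.Related.TypeIsomorphisms using (→-cong-⇔; ¬-cong-⇔)
open import Relation.Binary.PropositionalEquality
open import Relation.Nullary using (¬_; Dec; yes; no; does)
open import Relation.Nullary.Decidable
  using (map′; decidable-stable; ¬?; _×-dec_; _⊎-dec_; dec-true; dec-false; does-⇔)

-- Let C_M[N] be the cycle of length M in which every vertex is replaced by an
-- independent set (a cell) of N vertices. It is bipartite iff M is even. Deleting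
-- fewer than N vertices never disconnects it, so a conn_k atom with k < N holds
-- exactly when neither endpoint is deleted, and separator logic says no more about
-- C_M[N] than first-order logic over equality and the cyclic offsets between cells.
-- A back-and-forth argument then shows that C_M[N] and C_(M+1)[N] satisfy the same
-- sentences of quantifier rank q once M is large: with d rounds left, the chosen
-- vertices must realise the same equalities and the same offsets of absolute value
-- below 2^(d+1). A new vertex copies an old one, lies within the current window of an
-- old one (copy its offset into a fresh vertex of the corresponding cell), or is far
-- from all of them (fewer than M cells are near the chosen vertices, so a far cell
-- exists on the other side too).

does≡true⇒ : ∀ {A : Set} (a? : Dec A) → does a? ≡ true → A
does≡true⇒ (yes a) _ = a

both-false⇔ : ∀ {A B : Set} → ¬ A → ¬ B → A ⇔ B
both-false⇔ ¬a ¬b = mk⇔ (⊥-elim ∘ ¬a) (⊥-elim ∘ ¬b)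

≡-sym⇔ : ∀ {A : Set} {a b : A} → a ≡ b ⇔ b ≡ a
≡-sym⇔ = mk⇔ sym sym

module _ {A B : Set} {P : A → Set} {Q : B → Set} {R : A → B → Set}
         (forth : ∀ a → ∃ (R a)) (back : ∀ b → ∃ λ a → R a b) (P⇔Q : ∀ {a b} → R a b → P a ⇔ Q b) where

  Σ-⇔-backAndForth : Σ A P ⇔ Σ B Q
  Σ-⇔-backAndForth = mk⇔ (λ (a , pa) → let b , r = forth a in b , Equivalence.to (P⇔Q r) pa)
                         (λ (b , qb) → let a , r = back b in a , Equivalence.from (P⇔Q r) qb)

  Π-⇔-backAndForth : ((a : A) → P a) ⇔ ((b : B) → Q b)
  Π-⇔-backAndForth = mk⇔ (λ p b → let a , r = back b in Equivalence.to (P⇔Q r) (p a))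
                         (λ q a → let b , r = forth a in Equivalence.from (P⇔Q r) (q b))

-- Offsets on the cycle ℤ/M

toℤ : ∀ {M} → Fin M → ℤ
toℤ p = + toℕ p

record Offset {M : ℕ} (p q : Fin M) (z : ℤ) : Set where
  constructor offset
  field
    divisibility : + M ∣ toℤ q - (toℤ p + z)

module _ {M : ℕ} where

  multiple-below-modulus≡0 : ∀ {w} → + M ∣ w → ∣ w ∣ ℕ.< M → w ≡ 0ℤ
  multiple-below-modulus≡0 {w} M∣w ∣w∣<M with ∣ w ∣ in ∣w∣≡ | ∣⇒∣ᵤ M∣w
  ... | zero  | _     = ℤ.∣i∣≡0⇒i≡0 ∣w∣≡
  ... | suc _ | M∣∣w∣ = ⊥-elim (ℕ.<⇒≱ ∣w∣<M (ℕ.∣⇒≤ M∣∣w∣))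

  offset-refl : (p : Fin M) → Offset p p 0ℤ
  offset-refl p = offset (subst (+ M ∣_) (sym (a-[a+0]≡0 (toℤ p))) (divides 0ℤ refl))
    where a-[a+0]≡0 : ∀ a → a - (a + 0ℤ) ≡ 0ℤ
          a-[a+0]≡0 = solve-∀

  offset-sym : ∀ {p q : Fin M} {z} → Offset p q z → Offset q p (- z)
  offset-sym {p} {q} {z} (offset M∣) = offset (subst (+ M ∣_) (identity (toℤ p) (toℤ q) z) (∣m⇒∣-m M∣))
    where identity : ∀ a b z → - (b - (a + z)) ≡ a - (b + - z)
          identity = solve-∀

  offset-trans : ∀ {p q r : Fin M} {z w} → Offset p q z → Offset q r w → Offset p r (z + w)
  offset-trans {p} {q} {r} {z} {w} (offset M∣₁) (offset M∣₂) =
    offset (subst (+ M ∣_) (identity (toℤ p) (toℤ q) (toℤ r) z w) (∣m∣n⇒∣m+n M∣₂ M∣₁))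
    where identity : ∀ a b c z w → (c - (b + w)) + (b - (a + z)) ≡ c - (a + (z + w))
          identity = solve-∀

  offset-unique : ∀ {p q : Fin M} {z w} → Offset p q z → Offset p q w → ∣ z - w ∣ ℕ.< M → z ≡ w
  offset-unique {p} {q} {z} {w} (offset M∣₁) (offset M∣₂) small =
    ℤ.i-j≡0⇒i≡j z w
      (multiple-below-modulus≡0 (subst (+ M ∣_) (identity (toℤ p) (toℤ q) z w) (∣m∣n⇒∣m-n M∣₂ M∣₁)) small)
    where identity : ∀ a b z w → (b - (a + w)) - (b - (a + z)) ≡ z - w
          identity = solve-∀

  ∣toℤ-toℤ∣<M : (q r : Fin M) → ∣ toℤ q - toℤ r ∣ ℕ.< M
  ∣toℤ-toℤ∣<M q r rewrite ℤ.[+m]-[+n]≡m⊖n (toℕ q) (toℕ r) =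
    ℕ.≤-<-trans (ℤ.∣m⊝n∣≤m⊔n (toℕ q) (toℕ r)) (ℕ.⊔-lub (Fin.toℕ<n q) (Fin.toℕ<n r))

  offset-injective : ∀ {p q r : Fin M} {z} → Offset p q z → Offset p r z → q ≡ r
  offset-injective {p} {q} {r} {z} (offset M∣₁) (offset M∣₂) =
    Fin.toℕ-injective (ℤ.+-injective (ℤ.i-j≡0⇒i≡j (toℤ q) (toℤ r)
      (multiple-below-modulus≡0 (subst (+ M ∣_) (identity (toℤ p) (toℤ q) (toℤ r) z) (∣m∣n⇒∣m-n M∣₁ M∣₂))
                                (∣toℤ-toℤ∣<M q r))))
    where identity : ∀ a b c z → (b - (a + z)) - (c - (a + z)) ≡ b - c
          identity = solve-∀

  offset? : (p q : Fin M) (z : ℤ) → Dec (Offset p q z)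
  offset? p q z with + M ∣? toℤ q - (toℤ p + z)
  ... | yes M∣ = yes (offset M∣)
  ... | no ¬M∣ = no λ (offset M∣) → ¬M∣ M∣

  residue : .{{NonZero M}} → (a : ℤ) → ∃ λ (r : Fin M) → + M ∣ toℤ r - a
  residue a = fromℕ< (n%ℕd<d a M) , divides (- (a /ℕ M)) remainder-eq
    where
    remainder-eq : toℤ (fromℕ< (n%ℕd<d a M)) - a ≡ - (a /ℕ M) * + M
    remainder-eq = begin
      toℤ (fromℕ< (n%ℕd<d a M)) - a               ≡⟨ cong (λ r → + r - a) (Fin.toℕ-fromℕ< (n%ℕd<d a M)) ⟩
      + (a %ℕ M) - a                             ≡⟨ cong (λ b → + (a %ℕ M) - b) (a≡a%ℕn+[a/ℕn]*n a M) ⟩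
      + (a %ℕ M) - (+ (a %ℕ M) + (a /ℕ M) * + M) ≡⟨ identity (+ (a %ℕ M)) (a /ℕ M) (+ M) ⟩
      - (a /ℕ M) * + M                           ∎
      where open ≡-Reasoning
            identity : ∀ r q m → r - (r + q * m) ≡ - q * m
            identity = solve-∀

  offset-exists : .{{NonZero M}} → (p : Fin M) (z : ℤ) → ∃ λ q → Offset p q z
  offset-exists p z with residue (toℤ p + z)
  ... | q , M∣ = q , offset M∣

  offset-positive : .{{NonZero M}} → (p q : Fin M) → ∃ λ s → Offset p q (+ suc s)
  offset-positive p q with residue (toℤ q - toℤ p - 1ℤ)
  ... | r , M∣ = toℕ r , offset (subst (+ M ∣_) (identity (toℤ p) (toℤ q) (toℤ r)) (∣m⇒∣-m M∣))
    where identity : ∀ a b c → - (c - (b - a - 1ℤ)) ≡ b - (a + (1ℤ + c))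
          identity = solve-∀

  offset-period : ∀ {p q : Fin M} {z} → Offset p q z → Offset p q (z + + M)
  offset-period {p} {q} {z} (offset M∣) = offset (subst (+ M ∣_) (identity (toℤ p) (toℤ q) z (+ M)) (∣m∣n⇒∣m-n M∣ ∣-refl))
    where identity : ∀ a b z m → (b - (a + z)) - m ≡ b - (a + (z + m))
          identity = solve-∀

  offset-self : ∀ {p : Fin M} {z} → ∣ z ∣ ℕ.< M → Offset p p z ⇔ z ≡ 0ℤ
  offset-self {p} {z} small = mk⇔ (λ h → offset-unique h (offset-refl p) (subst (ℕ._< M) (sym (cong ∣_∣ (ℤ.+-identityʳ z))) small))
                                  (λ { refl → offset-refl p })

  offset-flip : ∀ {p q : Fin M} {z} → Offset p q (- z) ⇔ Offset q p z
  offset-flip {z = z} = mk⇔ (λ h → subst (Offset _ _) (ℤ.neg-involutive z) (offset-sym h)) offset-sym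

offset-via : ∀ {M} {p q r : Fin M} {z e} → Offset q r e → Offset p r z ⇔ Offset p q (z - e)
offset-via {z = z} {e} q→r = mk⇔ (λ p→r → offset-trans p→r (offset-sym q→r))
                                 (λ p→q → subst (Offset _ _) (identity z e) (offset-trans p→q q→r))
  where identity : ∀ z e → z - e + e ≡ z
        identity = solve-∀

offset-divisor : ∀ {d M} {p q : Fin M} {z} → + d ∣ + M → Offset p q z → + d ∣ toℤ q - toℤ p → + d ∣ z
offset-divisor {p = p} {q} {z} d∣M (offset M∣) d∣q-p =
  subst (_ ∣_) (identity (toℤ p) (toℤ q) z) (∣m∣n⇒∣m-n d∣q-p (∣-trans d∣M M∣))
  where identity : ∀ a b z → (b - a) - (b - (a + z)) ≡ z
        identity = solve-∀

Adjacent : ∀ {M} → Fin M → Fin M → Set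
Adjacent p q = Offset p q 1ℤ ⊎ Offset p q -1ℤ

adjacent? : ∀ {M} (p q : Fin M) → Dec (Adjacent p q)
adjacent? p q = offset? p q 1ℤ ⊎-dec offset? p q -1ℤ

adjacent-sym : ∀ {M} {p q : Fin M} → Adjacent p q → Adjacent q p
adjacent-sym (inj₁ h) = inj₂ (offset-sym h)
adjacent-sym (inj₂ h) = inj₁ (offset-sym h)

adjacent-irrefl : ∀ {M} → 2 ℕ.≤ M → {p : Fin M} → ¬ Adjacent p p
adjacent-irrefl 2≤M (inj₁ h) with () ← Equivalence.to (offset-self 2≤M) h
adjacent-irrefl 2≤M (inj₂ h) with () ← Equivalence.to (offset-self 2≤M) h

¬2∣unit : ∀ {z} → ∣ z ∣ ≡ 1 → ¬ (+ 2 ∣ z)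
¬2∣unit ∣z∣≡1 2∣z = ℕ.<⇒≱ (ℕ.s≤s (ℕ.s≤s ℕ.z≤n)) (ℕ.∣⇒≤ (subst (2 ℕ.∣_) ∣z∣≡1 (∣⇒∣ᵤ 2∣z)))

adjacent⇒¬2∣ : ∀ {M} {p q : Fin M} → 2 ℕ.∣ M → Adjacent p q → ¬ (+ 2 ∣ toℤ q - toℤ p)
adjacent⇒¬2∣ 2∣M (inj₁ h) 2∣q-p = ¬2∣unit refl (offset-divisor (∣ᵤ⇒∣ 2∣M) h 2∣q-p)
adjacent⇒¬2∣ 2∣M (inj₂ h) 2∣q-p = ¬2∣unit refl (offset-divisor (∣ᵤ⇒∣ 2∣M) h 2∣q-p)

isEven : ℕ → Bool
isEven x = x % 2 ℕ.≡ᵇ 0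

isEven-≡⇒%2-≡ : ∀ x y → isEven x ≡ isEven y → x % 2 ≡ y % 2
isEven-≡⇒%2-≡ x y same with x % 2 | y % 2 | m%n<n x 2 | m%n<n y 2
... | 0 | 0 | _ | _ = refl
... | 1 | 1 | _ | _ = refl
... | suc (suc _) | _ | ℕ.s≤s (ℕ.s≤s ()) | _
... | _ | suc (suc _) | _ | ℕ.s≤s (ℕ.s≤s ())

isEven-≡⇒2∣ : ∀ x y → isEven x ≡ isEven y → + 2 ∣ + y - + x
isEven-≡⇒2∣ x y same = divides (b - a) (begin
  + y - + x                     ≡⟨ cong₂ _-_ (halve y) (trans (halve x) (cong (λ t → + t + a * + 2) (isEven-≡⇒%2-≡ x y same))) ⟩
  (r + b * + 2) - (r + a * + 2) ≡⟨ identity r b a ⟩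
  (b - a) * + 2                 ∎)
  where
  open ≡-Reasoning
  r a b : ℤ
  r = + (y % 2)
  a = + (x / 2)
  b = + (y / 2)
  halve : ∀ x → + x ≡ + (x % 2) + + (x / 2) * + 2
  halve x = trans (cong +_ (m≡m%n+[m/n]*n x 2)) (trans (ℤ.pos-+ (x % 2) (x / 2 ℕ.* 2)) (cong (λ t → + (x % 2) + t) (ℤ.pos-* (x / 2) 2)))
  identity : ∀ r b a → (r + b * + 2) - (r + a * + 2) ≡ (b - a) * + 2
  identity = solve-∀

fold-not-even : ∀ b k → fold b not (2 ℕ.* k) ≡ b
fold-not-even b zero = refl
fold-not-even b (suc k) rewrite ℕ.+-suc k (k ℕ.+ 0) = trans (Bool.not-involutive _) (fold-not-even b k)

<⇒∃-∉-image : ∀ {m n} → m ℕ.< n → (f : Fin m → Fin n) → ∃ λ c → ∀ j → f j ≢ c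
<⇒∃-∉-image m<n f with Fin.any? (λ c → ¬? (Fin.any? (λ j → f j Fin.≟ c)))
... | yes (c , ∉image) = c , λ j fj≡c → ∉image (j , fj≡c)
... | no all-hit = ⊥-elim (ℕ.<⇒≱ m<n (Fin.injective⇒≤ preimage-injective))
  where
  hit : ∀ c → ∃ λ j → f j ≡ c
  hit c = decidable-stable (Fin.any? (λ j → f j Fin.≟ c)) (λ ∉image → all-hit (c , ∉image))
  preimage-injective : Injective _≡_ _≡_ (proj₁ ∘ hit)
  preimage-injective {c} {c′} same = trans (sym (proj₂ (hit c))) (trans (cong f same) (proj₂ (hit c′)))

signedFin : ∀ T → Fin (2 ℕ.* T) → ℤ
signedFin T t = toℕ t ⊖ T

signedFin-surjective : ∀ {T} z → ∣ z ∣ ℕ.< T → ∃ λ t → signedFin T t ≡ z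
signedFin-surjective {T} (+ n) n<T = fromℕ< T+n<2T , (begin
  toℕ (fromℕ< T+n<2T) ⊖ T ≡⟨ cong (_⊖ T) (Fin.toℕ-fromℕ< T+n<2T) ⟩
  (T ℕ.+ n) ⊖ T          ≡⟨ ℤ.⊖-≥ (ℕ.m≤m+n T n) ⟩
  + (T ℕ.+ n ℕ.∸ T)      ≡⟨ cong +_ (ℕ.m+n∸m≡n T n) ⟩
  + n                    ∎)
  where open ≡-Reasoning
        T+n<2T : T ℕ.+ n ℕ.< 2 ℕ.* T
        T+n<2T = subst (T ℕ.+ n ℕ.<_) (cong (T ℕ.+_) (sym (ℕ.+-identityʳ T))) (ℕ.+-monoʳ-< T n<T)
signedFin-surjective {T} -[1+ n ] 1+n<T = fromℕ< T∸[1+n]<2T , (begin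
  toℕ (fromℕ< T∸[1+n]<2T) ⊖ T ≡⟨ cong (_⊖ T) (Fin.toℕ-fromℕ< T∸[1+n]<2T) ⟩
  (T ℕ.∸ suc n) ⊖ T          ≡⟨ ℤ.⊖-< (ℕ.∸-monoʳ-< (ℕ.s≤s ℕ.z≤n) (ℕ.<⇒≤ 1+n<T)) ⟩
  - + (T ℕ.∸ (T ℕ.∸ suc n))  ≡⟨ cong (λ k → - + k) (ℕ.m∸[m∸n]≡n (ℕ.<⇒≤ 1+n<T)) ⟩
  -[1+ n ]                   ∎)
  where open ≡-Reasoning
        T∸[1+n]<2T : T ℕ.∸ suc n ℕ.< 2 ℕ.* T
        T∸[1+n]<2T = ℕ.<-≤-trans (ℕ.∸-monoʳ-< (ℕ.s≤s ℕ.z≤n) (ℕ.<⇒≤ 1+n<T)) (ℕ.m≤m+n T (T ℕ.+ 0))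

Near : ∀ {m M} → ℕ → (Fin m → Fin M) → Fin M → Set
Near T π q = ∃ λ i → ∃ λ z → ∣ z ∣ ℕ.< T × Offset (π i) q z

near? : ∀ {m M} T (π : Fin m → Fin M) q → Dec (Near T π q)
near? T π q = map′ fromFin toFin
  (Fin.any? λ i → Fin.any? λ t → (∣ signedFin T t ∣ ℕ.<? T) ×-dec offset? (π i) q (signedFin T t))
  where
  fromFin : (∃ λ i → ∃ λ t → ∣ signedFin T t ∣ ℕ.< T × Offset (π i) q (signedFin T t)) → Near T π q
  fromFin (i , t , small , h) = i , signedFin T t , small , h
  toFin : Near T π q → ∃ λ i → ∃ λ t → ∣ signedFin T t ∣ ℕ.< T × Offset (π i) q (signedFin T t)
  toFin (i , z , small , h) with signedFin-surjective z small
  ... | t , refl = i , t , small , h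

-- Each pair (i , t) rules out one cell, and there are fewer such pairs than cells.
far-position : ∀ {m M T} .{{_ : NonZero M}} → m ℕ.* (2 ℕ.* T) ℕ.< M → (π : Fin m → Fin M) → ∃ λ r → ¬ Near T π r
far-position {m} {M} {T} few π = r , far
  where
  target : Fin m × Fin (2 ℕ.* T) → Fin M
  target (i , t) = proj₁ (offset-exists (π i) (signedFin T t))
  blocked : Fin (m ℕ.* (2 ℕ.* T)) → Fin M
  blocked j = target (remQuot (2 ℕ.* T) j)
  r : Fin M
  r = proj₁ (<⇒∃-∉-image few blocked)
  far : ¬ Near T π r
  far (i , z , small , h) with signedFin-surjective z small
  ... | t , refl = proj₂ (<⇒∃-∉-image few blocked) (combine i t)
                     (trans (cong target (Fin.remQuot-combine i t)) (offset-injective (proj₂ (offset-exists (π i) (signedFin T t))) h))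

∣i-j∣<2*T : ∀ {T} i j → ∣ i ∣ ℕ.< T → ∣ j ∣ ℕ.< T → ∣ i - j ∣ ℕ.< 2 ℕ.* T
∣i-j∣<2*T {T} i j ∣i∣<T ∣j∣<T = ℕ.≤-<-trans (ℤ.∣i-j∣≤∣i∣+∣j∣ i j)
  (subst (∣ i ∣ ℕ.+ ∣ j ∣ ℕ.<_) (cong (T ℕ.+_) (sym (ℕ.+-identityʳ T))) (ℕ.+-mono-< ∣i∣<T ∣j∣<T))

reach⇒avoids : ∀ {G k} {cs : Vec (Vertex G) k} {a b} → Reach G cs a b → Avoids cs a × Avoids cs b
reach⇒avoids (here a∉) = a∉ , a∉
reach⇒avoids (step r _ c∉) = proj₁ (reach⇒avoids r) , c∉

avoids-map⇔ : ∀ {A B : Set} {m k} {ρ : Fin m → A} {σ : Fin m → B} → (∀ i j → ρ i ≡ ρ j ⇔ σ i ≡ σ j) →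
              (cs : Vec (Fin m) k) (x : Fin m) → Avoids (mapVec ρ cs) (ρ x) ⇔ Avoids (mapVec σ cs) (σ x)
avoids-map⇔ {ρ = ρ} {σ} same cs x =
  mk⇔ (λ ρx∉ i σcsi≡ → ρx∉ i (trans (Vec.lookup-map i ρ cs)
                                     (Equivalence.from (same _ x) (trans (sym (Vec.lookup-map i σ cs)) σcsi≡))))
      (λ σx∉ i ρcsi≡ → σx∉ i (trans (Vec.lookup-map i σ cs)
                                     (Equivalence.to (same _ x) (trans (sym (Vec.lookup-map i ρ cs)) ρcsi≡))))

quantifierRank : ∀ {m} → Formula m → ℕ
quantifierRank (neg φ)   = quantifierRank φ
quantifierRank (and φ ψ) = quantifierRank φ ℕ.⊔ quantifierRank ψ
quantifierRank (or φ ψ)  = quantifierRank φ ℕ.⊔ quantifierRank ψ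
quantifierRank (imp φ ψ) = quantifierRank φ ℕ.⊔ quantifierRank ψ
quantifierRank (ex φ)    = suc (quantifierRank φ)
quantifierRank (all φ)   = suc (quantifierRank φ)
quantifierRank _         = 0

maxArity : ∀ {m} → Formula m → ℕ
maxArity (conn k _ _ _) = k
maxArity (neg φ)        = maxArity φ
maxArity (and φ ψ)      = maxArity φ ℕ.⊔ maxArity ψ
maxArity (or φ ψ)       = maxArity φ ℕ.⊔ maxArity ψ
maxArity (imp φ ψ)      = maxArity φ ℕ.⊔ maxArity ψ
maxArity (ex φ)         = maxArity φ
maxArity (all φ)        = maxArity φ
maxArity _              = 0

-- Offsets below threshold d are the ones a formula of quantifier rank d can still detect.
threshold : ℕ → ℕ
threshold d = 2 ℕ.^ suc d

2≤threshold : ∀ d → 2 ℕ.≤ threshold d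
2≤threshold d = ℕ.^-monoʳ-≤ 2 (ℕ.s≤s (ℕ.z≤n {d}))

threshold-mono : ∀ {d e} → d ℕ.≤ e → threshold d ℕ.≤ threshold e
threshold-mono d≤e = ℕ.^-monoʳ-≤ 2 (ℕ.s≤s d≤e)

-- The blown-up cycle

module _ (N : ℕ) where

  cell : ∀ M → Fin (M ℕ.* N) → Fin M
  cell M v = proj₁ (remQuot {M} N v)

  cell-combine : ∀ {M} (p : Fin M) c → cell M (combine p c) ≡ p
  cell-combine p c = cong proj₁ (Fin.remQuot-combine p c)

  -- ρ j rules out only its own column of p's cell.
  fresh-vertex : ∀ {M m} → m ℕ.< N → (p : Fin M) (ρ : Fin m → Fin (M ℕ.* N)) →
                 ∃ λ v → cell M v ≡ p × ∀ j → ρ j ≢ v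
  fresh-vertex {M} m<N p ρ with <⇒∃-∉-image m<N (λ j → proj₂ (remQuot {M} N (ρ j)))
  ... | c , ∉image = combine p c , cell-combine p c ,
                     λ j ρj≡ → ∉image j (trans (cong (proj₂ ∘ remQuot {M} N) ρj≡) (cong proj₂ (Fin.remQuot-combine p c)))

  module CycleBlowUp (M : ℕ) (2≤M : 2 ℕ.≤ M) where

    instance
      M-nonZero : NonZero M
      M-nonZero = ℕ.>-nonZero (ℕ.<-≤-trans (ℕ.s≤s ℕ.z≤n) 2≤M)

    graph : Graph
    graph = record
      { n = M ℕ.* N
      ; adj = λ u v → does (adjacent? (cell M u) (cell M v))
      ; irrefl = λ v → dec-false (adjacent? (cell M v) (cell M v)) (adjacent-irrefl 2≤M)
      ; sym = λ u v → does-⇔ (mk⇔ adjacent-sym adjacent-sym) (adjacent? (cell M u) (cell M v)) (adjacent? (cell M v) (cell M u))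
      }

    edge⇔ : ∀ {u v} → Edge graph u v ⇔ Adjacent (cell M u) (cell M v)
    edge⇔ {u} {v} = mk⇔ (does≡true⇒ (adjacent? (cell M u) (cell M v))) (dec-true (adjacent? (cell M u) (cell M v)))

    -- Walk forward through fresh vertices of the intermediate cells.
    reach-by-offset : ∀ {k} → k ℕ.< N → {cs : Vec (Vertex graph) k} {a b : Vertex graph} →
                      Avoids cs a → Avoids cs b → ∀ s → Offset (cell M a) (cell M b) (+ suc s) → Reach graph cs a b
    reach-by-offset k<N a∉ b∉ zero a→b = step (here a∉) (Equivalence.from edge⇔ (inj₁ a→b)) b∉
    reach-by-offset k<N {cs} {b = b} a∉ b∉ (suc s) a→b with offset-exists (cell M b) -1ℤ
    ... | r , b→r with fresh-vertex k<N r (lookup cs)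
    ... | w , refl , w∉ =
      step (reach-by-offset k<N a∉ w∉ s (offset-trans a→b b→r)) (Equivalence.from edge⇔ (inj₁ (offset-sym b→r))) b∉

    reach⇔avoids : ∀ {k} → k ℕ.< N → {cs : Vec (Vertex graph) k} {a b : Vertex graph} →
                   Reach graph cs a b ⇔ (Avoids cs a × Avoids cs b)
    reach⇔avoids k<N {a = a} {b} =
      mk⇔ reach⇒avoids λ (a∉ , b∉) → reach-by-offset k<N a∉ b∉ _ (proj₂ (offset-positive (cell M a) (cell M b)))

    even-cycle⇒bipartite : 2 ℕ.∣ M → Bipartite graph
    even-cycle⇒bipartite 2∣M = isEven ∘ toℕ ∘ cell M , proper
      where proper : ∀ u v → Edge graph u v → isEven (toℕ (cell M u)) ≢ isEven (toℕ (cell M v))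
            proper u v e same = adjacent⇒¬2∣ 2∣M (Equivalence.to edge⇔ e) (isEven-≡⇒2∣ (toℕ (cell M u)) (toℕ (cell M v)) same)

    odd-cycle⇒¬bipartite : ∀ k → M ≡ suc (2 ℕ.* k) → Vertex graph → ¬ Bipartite graph
    odd-cycle⇒¬bipartite k M≡ v₀ (col , proper) = Bool.not-¬ refl col-around
      where
      position : ℕ → Fin M
      position p = proj₁ (offset-exists (cell M v₀) (+ p))

      vertex : ℕ → Vertex graph
      vertex p = combine (position p) (proj₂ (remQuot {M} N v₀))

      at : ∀ p → Offset (cell M v₀) (position p) (+ p)
      at p = proj₂ (offset-exists (cell M v₀) (+ p))

      vertex-cell : ∀ p → cell M (vertex p) ≡ position p
      vertex-cell p = cell-combine (position p) (proj₂ (remQuot {M} N v₀))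

      consecutive : ∀ p → Edge graph (vertex p) (vertex (suc p))
      consecutive p = Equivalence.from (edge⇔ {vertex p} {vertex (suc p)})
        (inj₁ (subst₂ (λ a b → Offset a b 1ℤ) (sym (vertex-cell p)) (sym (vertex-cell (suc p)))
                      (subst (Offset _ _) (identity (+ p)) (offset-trans (offset-sym (at p)) (at (suc p))))))
        where identity : ∀ a → - a + (1ℤ + a) ≡ 1ℤ
              identity = solve-∀

      alternating : ∀ p → col (vertex p) ≡ fold (col (vertex 0)) not p
      alternating zero = refl
      alternating (suc p) = trans (Bool.¬-not (≢-sym (proper _ _ (consecutive p)))) (cong not (alternating p))

      around : vertex M ≡ vertex 0
      around = cong (λ r → combine r (proj₂ (remQuot {M} N v₀)))
                    (offset-injective (at M) (offset-period (at 0)))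

      col-around : col (vertex 0) ≡ not (col (vertex 0))
      col-around = begin
        col (vertex 0)                   ≡⟨ cong col around ⟨
        col (vertex M)                   ≡⟨ alternating M ⟩
        fold (col (vertex 0)) not M      ≡⟨ cong (fold (col (vertex 0)) not) M≡ ⟩
        not (fold (col (vertex 0)) not (2 ℕ.* k)) ≡⟨ cong not (fold-not-even (col (vertex 0)) k) ⟩
        not (col (vertex 0))             ∎
        where open ≡-Reasoning

  -- The back-and-forth game

  record Similar (M M′ T : ℕ) {m} (ρ : Fin m → Fin (M ℕ.* N)) (σ : Fin m → Fin (M′ ℕ.* N)) : Set where
    field
      same⇔   : ∀ i j → ρ i ≡ ρ j ⇔ σ i ≡ σ j
      offset⇔ : ∀ i j {z} → ∣ z ∣ ℕ.< T → Offset (cell M (ρ i)) (cell M (ρ j)) z ⇔ Offset (cell M′ (σ i)) (cell M′ (σ j)) z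
  open Similar

  similar-empty : ∀ {M M′ T} → Similar M M′ T emptyAssign emptyAssign
  similar-empty = record { same⇔ = λ () ; offset⇔ = λ () }

  module _ {M M′ T m : ℕ} {ρ : Fin m → Fin (M ℕ.* N)} {σ : Fin m → Fin (M′ ℕ.* N)} where

    similar-sym : Similar M M′ T ρ σ → Similar M′ M T σ ρ
    similar-sym s = record { same⇔ = λ i j → ⇔.sym (same⇔ s i j) ; offset⇔ = λ i j small → ⇔.sym (offset⇔ s i j small) }

    similar-weaken : ∀ {T′} → T ℕ.≤ T′ → Similar M M′ T′ ρ σ → Similar M M′ T ρ σ
    similar-weaken T≤T′ s = record { same⇔ = same⇔ s ; offset⇔ = λ i j small → offset⇔ s i j (ℕ.<-≤-trans small T≤T′) }

    similar-extend : T ℕ.≤ M → T ℕ.≤ M′ → Similar M M′ T ρ σ → ∀ {x y} →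
                     (∀ k → x ≡ ρ k ⇔ y ≡ σ k) →
                     (∀ k {z} → ∣ z ∣ ℕ.< T → Offset (cell M (ρ k)) (cell M x) z ⇔ Offset (cell M′ (σ k)) (cell M′ y) z) →
                     Similar M M′ T (extend x ρ) (extend y σ)
    similar-extend T≤M T≤M′ s {x} {y} new-same new-offset = record { same⇔ = same⇔′ ; offset⇔ = offset⇔′ }
      where
      same⇔′ : ∀ i j → extend x ρ i ≡ extend x ρ j ⇔ extend y σ i ≡ extend y σ j
      same⇔′ zero    zero    = mk⇔ (λ _ → refl) (λ _ → refl)
      same⇔′ zero    (suc l) = new-same l
      same⇔′ (suc k) zero    = ⇔.trans ≡-sym⇔ (⇔.trans (new-same k) ≡-sym⇔)
      same⇔′ (suc k) (suc l) = same⇔ s k l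

      offset⇔′ : ∀ i j {z} → ∣ z ∣ ℕ.< T → Offset (cell M (extend x ρ i)) (cell M (extend x ρ j)) z
                                          ⇔ Offset (cell M′ (extend y σ i)) (cell M′ (extend y σ j)) z
      offset⇔′ zero    zero    small =
        ⇔.trans (offset-self (ℕ.<-≤-trans small T≤M)) (⇔.sym (offset-self (ℕ.<-≤-trans small T≤M′)))
      offset⇔′ zero    (suc l) {z} small =
        ⇔.trans (⇔.sym offset-flip) (⇔.trans (new-offset l (subst (ℕ._< T) (sym (ℤ.∣-i∣≡∣i∣ z)) small)) offset-flip)
      offset⇔′ (suc k) zero    small = new-offset k small
      offset⇔′ (suc k) (suc l) small = offset⇔ s k l small

  module _ {M M′ T m : ℕ} .{{_ : NonZero M′}}
           (T≤M : T ℕ.≤ M) (T≤M′ : T ℕ.≤ M′) (m<N : m ℕ.< N) (few : m ℕ.* (2 ℕ.* T) ℕ.< M′)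
           {ρ : Fin m → Fin (M ℕ.* N)} {σ : Fin m → Fin (M′ ℕ.* N)} (s : Similar M M′ (2 ℕ.* T) ρ σ) where

    private
      s′ : Similar M M′ T ρ σ
      s′ = similar-weaken (ℕ.m≤m+n T (T ℕ.+ 0)) s

      new-same : ∀ {x y} → (∀ k → x ≢ ρ k) → (∀ k → σ k ≢ y) → ∀ k → x ≡ ρ k ⇔ y ≡ σ k
      new-same x∉ρ y∉σ k = both-false⇔ (x∉ρ k) (y∉σ k ∘ sym)

      forth-near : ∀ {x} → (∀ k → x ≢ ρ k) → Near T (cell M ∘ ρ) (cell M x) →
                   ∃ λ y → Similar M M′ T (extend x ρ) (extend y σ)
      forth-near {x} x∉ρ (i , e , ∣e∣<T , ρi→x) with offset-exists (cell M′ (σ i)) e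
      ... | r , σi→r with fresh-vertex m<N r σ
      ... | y , refl , y∉σ = y , similar-extend T≤M T≤M′ s′ (new-same x∉ρ y∉σ) new-offset
        where
        new-offset : ∀ k {z} → ∣ z ∣ ℕ.< T → Offset (cell M (ρ k)) (cell M x) z ⇔ Offset (cell M′ (σ k)) (cell M′ y) z
        new-offset k {z} small =
          ⇔.trans (offset-via ρi→x) (⇔.trans (offset⇔ s k i (∣i-j∣<2*T z e small ∣e∣<T)) (⇔.sym (offset-via σi→r)))

      forth-far : ∀ {x} → (∀ k → x ≢ ρ k) → ¬ Near T (cell M ∘ ρ) (cell M x) →
                  ∃ λ y → Similar M M′ T (extend x ρ) (extend y σ)
      forth-far {x} x∉ρ x-far with far-position few (cell M′ ∘ σ)
      ... | r , r-far with fresh-vertex m<N r σ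
      ... | y , refl , y∉σ = y , similar-extend T≤M T≤M′ s′ (new-same x∉ρ y∉σ)
                                   (λ k small → both-false⇔ (λ h → x-far (k , _ , small , h)) (λ h → r-far (k , _ , small , h)))

    forth : ∀ x → ∃ λ y → Similar M M′ T (extend x ρ) (extend y σ)
    forth x with Fin.any? (λ k → x Fin.≟ ρ k)
    ... | yes (k , refl) = σ k , similar-extend T≤M T≤M′ s′ (same⇔ s′ k) (λ l → offset⇔ s′ l k)
    ... | no x∉ρ with near? T (cell M ∘ ρ) (cell M x)
    ...   | yes near = forth-near (λ k x≡ → x∉ρ (k , x≡)) near
    ...   | no far   = forth-far (λ k x≡ → x∉ρ (k , x≡)) far

  -- suc Q * threshold Q ≤ M leaves room for a far cell in every round.
  module Transfer (M₁ M₂ Q : ℕ) (Q<N : Q ℕ.< N)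
                  (large₁ : suc Q ℕ.* threshold Q ℕ.≤ M₁) (large₂ : suc Q ℕ.* threshold Q ℕ.≤ M₂) where

    private
      threshold≤ : ∀ {M d} → suc Q ℕ.* threshold Q ℕ.≤ M → d ℕ.≤ Q → threshold d ℕ.≤ M
      threshold≤ {d = d} large d≤Q = ℕ.≤-trans (threshold-mono d≤Q) (ℕ.m+n≤o⇒m≤o (threshold Q) large)

      few≤ : ∀ {M m e} → suc Q ℕ.* threshold Q ℕ.≤ M → m ℕ.≤ Q → e ℕ.≤ Q → m ℕ.* threshold e ℕ.< M
      few≤ large m≤Q e≤Q = ℕ.≤-<-trans (ℕ.*-mono-≤ m≤Q (threshold-mono e≤Q))
                                       (ℕ.<-≤-trans (ℕ.m<n+m _ (ℕ.m^n>0 2 (suc Q))) large)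

    module G₁ = CycleBlowUp M₁ (threshold≤ large₁ ℕ.z≤n)
    module G₂ = CycleBlowUp M₂ (threshold≤ large₂ ℕ.z≤n)

    back-and-forth : ∀ {m d} → m ℕ.+ suc d ℕ.≤ Q → {ρ : Fin m → Fin (M₁ ℕ.* N)} {σ : Fin m → Fin (M₂ ℕ.* N)} →
                     Similar M₁ M₂ (threshold (suc d)) ρ σ →
                     (∀ v → ∃ λ w → Similar M₁ M₂ (threshold d) (extend v ρ) (extend w σ)) ×
                     (∀ w → ∃ λ v → Similar M₁ M₂ (threshold d) (extend v ρ) (extend w σ))
    back-and-forth {m} {d} room s =
      forth {{G₂.M-nonZero}} T≤M₁ T≤M₂ m<N (few≤ large₂ m≤Q 1+d≤Q) s ,
      λ w → let v , s′ = forth {{G₁.M-nonZero}} T≤M₂ T≤M₁ m<N (few≤ large₁ m≤Q 1+d≤Q) (similar-sym s) w in v , similar-sym s′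
      where
      m≤Q : m ℕ.≤ Q
      m≤Q = ℕ.m+n≤o⇒m≤o m room
      1+d≤Q : suc d ℕ.≤ Q
      1+d≤Q = ℕ.m+n≤o⇒n≤o m room
      m<N : m ℕ.< N
      m<N = ℕ.≤-<-trans m≤Q Q<N
      T≤M₁ : threshold d ℕ.≤ M₁
      T≤M₁ = threshold≤ large₁ (ℕ.<⇒≤ 1+d≤Q)
      T≤M₂ : threshold d ℕ.≤ M₂
      T≤M₂ = threshold≤ large₂ (ℕ.<⇒≤ 1+d≤Q)

    transfer : ∀ {m} (φ : Formula m) {d} → quantifierRank φ ℕ.≤ d → m ℕ.+ d ℕ.≤ Q → maxArity φ ℕ.< N →
               {ρ : Fin m → Fin (M₁ ℕ.* N)} {σ : Fin m → Fin (M₂ ℕ.* N)} → Similar M₁ M₂ (threshold d) ρ σ →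
               Sat G₁.graph ρ φ ⇔ Sat G₂.graph σ φ
    transfer (eq x y) _ _ _ s = same⇔ s x y
    transfer (edge x y) {d} _ _ _ s =
      ⇔.trans G₁.edge⇔ (⇔.trans (offset⇔ s x y (2≤threshold d) ⊎-⇔ offset⇔ s x y (2≤threshold d)) (⇔.sym G₂.edge⇔))
    transfer (conn k x y cs) _ _ k<N s =
      ⇔.trans (G₁.reach⇔avoids k<N)
        (⇔.trans (avoids-map⇔ (same⇔ s) cs x ×-⇔ avoids-map⇔ (same⇔ s) cs y) (⇔.sym (G₂.reach⇔avoids k<N)))
    transfer ⊤f _ _ _ _ = ⇔.refl
    transfer ⊥f _ _ _ _ = ⇔.refl
    transfer (neg φ) qr≤d room arity<N s = ¬-cong-⇔ (transfer φ qr≤d room arity<N s)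
    transfer (and φ ψ) qr≤d room arity<N s =
      transfer φ (ℕ.m⊔n≤o⇒m≤o _ _ qr≤d) room (ℕ.m⊔n<o⇒m<o _ _ arity<N) s ×-⇔
      transfer ψ (ℕ.m⊔n≤o⇒n≤o _ _ qr≤d) room (ℕ.m⊔n<o⇒n<o _ _ arity<N) s
    transfer (or φ ψ) qr≤d room arity<N s =
      transfer φ (ℕ.m⊔n≤o⇒m≤o _ _ qr≤d) room (ℕ.m⊔n<o⇒m<o _ _ arity<N) s ⊎-⇔
      transfer ψ (ℕ.m⊔n≤o⇒n≤o _ _ qr≤d) room (ℕ.m⊔n<o⇒n<o _ _ arity<N) s
    transfer (imp φ ψ) qr≤d room arity<N s =
      →-cong-⇔ (transfer φ (ℕ.m⊔n≤o⇒m≤o _ _ qr≤d) room (ℕ.m⊔n<o⇒m<o _ _ arity<N) s)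
               (transfer ψ (ℕ.m⊔n≤o⇒n≤o _ _ qr≤d) room (ℕ.m⊔n<o⇒n<o _ _ arity<N) s)
    transfer {m} (ex φ) {suc d} (ℕ.s≤s qr≤d) room arity<N s =
      Σ-⇔-backAndForth (proj₁ (back-and-forth room s)) (proj₂ (back-and-forth room s))
                         (transfer φ qr≤d (subst (ℕ._≤ Q) (ℕ.+-suc m d) room) arity<N)
    transfer {m} (all φ) {suc d} (ℕ.s≤s qr≤d) room arity<N s =
      Π-⇔-backAndForth (proj₁ (back-and-forth room s)) (proj₂ (back-and-forth room s))
                         (transfer φ qr≤d (subst (ℕ._≤ Q) (ℕ.+-suc m d) room) arity<N)

mainTheorem3 : ¬ (Σ Sentence λ φ → (G : Graph) → ((G ⊨ φ → Bipartite G) × (Bipartite G → G ⊨ φ)))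
mainTheorem3 (φ , defines) = G₂.odd-cycle⇒¬bipartite B refl zero (proj₁ (defines G₂.graph) G₂⊨φ)
  where
  Q B N : ℕ
  Q = quantifierRank φ
  B = suc Q ℕ.* threshold Q
  N = suc (Q ℕ.+ maxArity φ)
  open Transfer N (2 ℕ.* B) (suc (2 ℕ.* B)) Q (ℕ.s≤s (ℕ.m≤m+n Q _))
                (ℕ.m≤m+n B (B ℕ.+ 0)) (ℕ.m≤n⇒m≤1+n (ℕ.m≤m+n B (B ℕ.+ 0)))
  G₁⊨φ : G₁.graph ⊨ φ
  G₁⊨φ = proj₂ (defines G₁.graph) (G₁.even-cycle⇒bipartite (ℕ.m∣m*n B))
  G₂⊨φ : G₂.graph ⊨ φ
  G₂⊨φ = Equivalence.to (transfer φ ℕ.≤-refl ℕ.≤-refl (ℕ.s≤s (ℕ.m≤n+m _ Q)) (similar-empty N)) G₁⊨φ
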